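{- Let $G_1$ and $G_2$ be finite simple graphs (either may be the empty graph). Then the inductive dimension of their join satisfies $$\mathrm{dim}\,(G_1+G_2)=1+\mathrm{dim}\,G_1+\mathrm{dim}\,G_2.$$
   Context: All graphs are finite simple graphs; $|G|$ is the number of vertices of $G$. The join (Zykov sum) $G_1+G_2$ of two graphs is the graph obtained from the disjoint union of $G_1$ and $G_2$ by adding an edge between every vertex of $G_1$ and every vertex of $G_2$. For a vertex $v$ of $G$, the unit sphere $S_G(v)$ is the subgraph of $G$ induced on the set of neighbors of $v$ (the vertices at distance exactly $1$ from $v$). The inductive dimension is defined recursively: $\mathrm{dim}\,G=-1$ if $G$ is the empty graph (no vertices); otherwise $\mathrm{dim}\,G=\frac{1}{|G|}\sum_{v\in V(G)}\mathrm{dim}_G(v)$, where $\mathrm{dim}_G(v)=1+\mathrm{dim}\,S_G(v)$. -}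

module Defs where

open import Data.Bool using (Bool; true; false)
open import Data.Nat as ℕ using (ℕ; zero; suc)
open import Data.Fin using (Fin; splitAt)
open import Data.Sum using (_⊎_; inj₁; inj₂)
open import Data.List using (List; length; lookup; filterᵇ; allFin; map; foldr)
open import Data.Integer using (+_)
open import Data.Rational using (ℚ; _+_; _*_; _/_; -_; 0ℚ; 1ℚ)
open import Relation.Binary.PropositionalEquality using (_≡_; refl)

record Graph : Set where
  constructor graph
  field
    n      : ℕ
    adj    : Fin n → Fin n → Bool
    sym    : ∀ i j → adj i j ≡ adj j i
    irrefl : ∀ i → adj i i ≡ false
open Graph public

∣_∣ : Graph → ℕ
∣ G ∣ = n G

induced : (G : Graph) (m : ℕ) → (Fin m → Fin (n G)) → Graph
induced G m e = graph m (λ i j → adj G (e i) (e j))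
                        (λ i j → sym G (e i) (e j))
                        (λ i → irrefl G (e i))

neighbours : (G : Graph) → Fin (n G) → List (Fin (n G))
neighbours G v = filterᵇ (adj G v) (allFin (n G))

sphere : (G : Graph) → Fin (n G) → Graph
sphere G v = induced G (length (neighbours G v)) (lookup (neighbours G v))

sumℚ : List ℚ → ℚ
sumℚ = foldr _+_ 0ℚ

-- With k = |G| the fuel never runs out prematurely: the sphere of a vertex
-- has at most |G| - 1 vertices (irreflexivity), and fuel 0 is only reached
-- on graphs with 0 vertices, where the value -1 is the correct one.
dimAux : ℕ → Graph → ℚ
dimAux zero    G = - 1ℚ
dimAux (suc k) (graph zero adj sym irrefl) = - 1ℚ
dimAux (suc k) G@(graph (suc m) adj sym irrefl) =
  sumℚ (map (λ v → 1ℚ + dimAux k (sphere G v)) (allFin (suc m))) * (+ 1 / suc m)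

dim : Graph → ℚ
dim G = dimAux ∣ G ∣ G

joinAdj : (G₁ G₂ : Graph) → Fin (n G₁) ⊎ Fin (n G₂) → Fin (n G₁) ⊎ Fin (n G₂) → Bool
joinAdj G₁ G₂ (inj₁ a) (inj₁ b) = adj G₁ a b
joinAdj G₁ G₂ (inj₂ a) (inj₂ b) = adj G₂ a b
joinAdj G₁ G₂ (inj₁ a) (inj₂ b) = true
joinAdj G₁ G₂ (inj₂ a) (inj₁ b) = true

joinAdj-sym : (G₁ G₂ : Graph) → ∀ x y → joinAdj G₁ G₂ x y ≡ joinAdj G₁ G₂ y x
joinAdj-sym G₁ G₂ (inj₁ a) (inj₁ b) = sym G₁ a b
joinAdj-sym G₁ G₂ (inj₂ a) (inj₂ b) = sym G₂ a b
joinAdj-sym G₁ G₂ (inj₁ a) (inj₂ b) = refl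
joinAdj-sym G₁ G₂ (inj₂ a) (inj₁ b) = refl

joinAdj-irrefl : (G₁ G₂ : Graph) → ∀ x → joinAdj G₁ G₂ x x ≡ false
joinAdj-irrefl G₁ G₂ (inj₁ a) = irrefl G₁ a
joinAdj-irrefl G₁ G₂ (inj₂ a) = irrefl G₂ a

join : Graph → Graph → Graph
join G₁ G₂ = graph (n G₁ ℕ.+ n G₂)
  (λ i j → joinAdj G₁ G₂ (splitAt (n G₁) i) (splitAt (n G₁) j))
  (λ i j → joinAdj-sym G₁ G₂ (splitAt (n G₁) i) (splitAt (n G₁) j))
  (λ i → joinAdj-irrefl G₁ G₂ (splitAt (n G₁) i))

-- Summing dim_J(v) over the vertices of J = G₁ + G₂ splits into the vertices of G₁
-- and those of G₂. For a vertex a of G₁ the unit sphere in J is isomorphic to the join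
-- S_{G₁}(a) + G₂, which has fewer vertices than J, so by induction
-- dim_J(a) = 1 + (1 + dim S_{G₁}(a) + dim G₂) = dim_{G₁}(a) + (1 + dim G₂), and
-- symmetrically for G₂. Since Σ_v dim_G(v) = |G| · dim G, the total is
-- |G₁| (1 + dim G₁ + dim G₂) + |G₂| (1 + dim G₁ + dim G₂), whence the formula.
module Submission where

open import Defs
open import Data.Rational using (ℚ; _+_; 1ℚ)
open import Relation.Binary.PropositionalEquality using (_≡_)

open import Data.Bool using (Bool; true; T; T?)
open import Data.Bool.Properties using (T-≡)
open import Data.Empty using (⊥)
open import Data.Fin using (Fin; zero; suc; _↑ˡ_; _↑ʳ_; splitAt)
import Data.Fin as Fin
open import Data.Fin.Properties using (splitAt-↑ˡ; splitAt-↑ʳ; splitAt-join; join-splitAt)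
open import Data.Fin.Permutation using (Permutation; permutation; ↔⇒≡)
import Data.Integer as ℤ
import Data.Integer.Properties as ℤ
open import Data.List using (List; _∷_; length; lookup; tabulate; allFin; map)
open import Data.List.Properties using (map-tabulate; length-tabulate; filter-notAll)
open import Data.List.Membership.Propositional using (_∈_)
open import Data.List.Membership.Propositional.Properties using (∈-lookup; ∈-allFin; ∈-filter⁺; ∈-filter⁻)
open import Data.List.Membership.Propositional.Properties.WithK using (unique⇒irrelevant)
open import Data.List.Relation.Unary.Any using (index)
import Data.List.Relation.Unary.Any as Any
open import Data.List.Relation.Unary.Any.Properties using (lookup-index)
open import Data.List.Relation.Unary.Unique.Propositional using (Unique)
open import Data.List.Relation.Unary.Unique.Propositional.Properties using (filter⁺; allFin⁺)
open import Data.Nat as ℕ using (ℕ; zero; suc; _≤_; _<_; z<s)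
open import Data.Nat.Induction using (<-rec)
import Data.Nat.Properties as ℕ
import Data.Nat.Coprimality as Coprime
open import Data.Product using (Σ; _,_; proj₁; proj₂)
open import Data.Rational using (mkℚ; _*_; _/_)
open import Data.Rational.Properties
  using (+-0-commutativeMonoid; +-*-ring; normalize-coprime; *-inverseʳ; *-comm; *-identityʳ; +-identityˡ; +-assoc)
open import Data.Rational.Solver using (module +-*-Solver)
open import Data.Sum using (_⊎_; inj₁; inj₂; swap)
import Data.Sum as Sum
open import Data.Sum.Properties using (swap-involutive; inj₁-injective; inj₂-injective)
open import Function using (_∘_; id; Equivalence)
open import Algebra.Bundles using (Ring)
open import Algebra.Properties.CommutativeMonoid.Sum +-0-commutativeMonoid
  using (sum; sum-cong-≗; ∑-distrib-+; sum-permute; sum-replicate)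
open import Algebra.Properties.CommutativeMonoid.Mult +-0-commutativeMonoid
  using (_×_; ×-distrib-+; ×-homo-+)
open import Algebra.Properties.Semiring.Mult (Ring.semiring +-*-ring) using (×-comm-*; ×-assoc-*)
open import Relation.Binary.PropositionalEquality as ≡
  using (refl; trans; cong; cong₂; subst; module ≡-Reasoning)

open ≡-Reasoning

×1ℚ-mkℚ : ∀ n → n × 1ℚ ≡ mkℚ (ℤ.+ n) 0 (Coprime.sym (Coprime.1-coprimeTo n))
×1ℚ-mkℚ zero    = refl
×1ℚ-mkℚ (suc n) rewrite ×1ℚ-mkℚ n =
  trans (cong (λ i → (ℤ.+ 1 ℤ.+ i) / 1) (ℤ.*-identityʳ (ℤ.+ n)))
        (normalize-coprime (Coprime.sym (Coprime.1-coprimeTo (suc n))))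

n×[1/n]≡1 : ∀ m → suc m × (ℤ.+ 1 / suc m) ≡ 1ℚ
-- Both factors normalise to coprime fractions, (m+1)/1 and 1/(m+1), on which 1/_ computes.
n×[1/n]≡1 m = begin
  suc m × r          ≡⟨ cong (suc m ×_) (*-identityʳ r) ⟨
  suc m × (r * 1ℚ)   ≡⟨ ×-comm-* (suc m) r 1ℚ ⟨
  r * (suc m × 1ℚ)   ≡⟨ cong₂ _*_ (normalize-coprime (Coprime.1-coprimeTo (suc m))) (×1ℚ-mkℚ (suc m)) ⟩
  1/N * N            ≡⟨ *-comm 1/N N ⟩
  N * 1/N            ≡⟨ *-inverseʳ N ⟩
  1ℚ                 ∎
  where
  r   = ℤ.+ 1 / suc m
  N   = mkℚ (ℤ.+ suc m) 0 (Coprime.sym (Coprime.1-coprimeTo (suc m)))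
  1/N = mkℚ (ℤ.+ 1) m (Coprime.1-coprimeTo (suc m))

n×[x/n]≡x : ∀ m x → suc m × (x * (ℤ.+ 1 / suc m)) ≡ x
n×[x/n]≡x m x = begin
  suc m × (x * r)   ≡⟨ ×-comm-* (suc m) x r ⟨
  x * (suc m × r)   ≡⟨ cong (x *_) (n×[1/n]≡1 m) ⟩
  x * 1ℚ            ≡⟨ *-identityʳ x ⟩
  x                 ∎
  where r = ℤ.+ 1 / suc m

[n×x]/n≡x : ∀ m x → (suc m × x) * (ℤ.+ 1 / suc m) ≡ x
[n×x]/n≡x m x = trans (×-assoc-* (suc m) x (ℤ.+ 1 / suc m)) (n×[x/n]≡x m x)

sumℚ-tabulate : ∀ n (f : Fin n → ℚ) → sumℚ (tabulate f) ≡ sum f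
sumℚ-tabulate zero    f = refl
sumℚ-tabulate (suc n) f = cong (f zero +_) (sumℚ-tabulate n (f ∘ suc))

sumℚ-allFin : ∀ n (f : Fin n → ℚ) → sumℚ (map f (allFin n)) ≡ sum f
sumℚ-allFin n f = trans (cong sumℚ (map-tabulate id f)) (sumℚ-tabulate n f)

sum-↑ˡ-↑ʳ : ∀ m n (f : Fin (m ℕ.+ n) → ℚ) → sum f ≡ sum (f ∘ (_↑ˡ n)) + sum (f ∘ (m ↑ʳ_))
sum-↑ˡ-↑ʳ zero    n f = ≡.sym (+-identityˡ (sum f))
sum-↑ˡ-↑ʳ (suc m) n f = trans (cong (f zero +_) (sum-↑ˡ-↑ʳ m n (f ∘ suc)))
  (≡.sym (+-assoc (f zero) (sum (f ∘ suc ∘ (_↑ˡ n))) (sum (f ∘ suc ∘ (m ↑ʳ_)))))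

-- The dimension as an average

dimAt : (G : Graph) → Fin ∣ G ∣ → ℚ
dimAt G v = 1ℚ + dim (sphere G v)

sphere-smaller : ∀ G v → ∣ sphere G v ∣ < ∣ G ∣
sphere-smaller G v = subst (length (neighbours G v) <_) (length-tabulate {n = ∣ G ∣} id)
  (filter-notAll (T? ∘ adj G v) (allFin ∣ G ∣) (Any.map (λ { refl → v∉S[v] }) (∈-allFin v)))
  where
  v∉S[v] : T (adj G v v) → ⊥
  v∉S[v] = subst T (irrefl G v)

dimAux-suc : ∀ k {m} (G : Graph) → ∣ G ∣ ≡ suc m →
             dimAux (suc k) G ≡ sum (λ v → 1ℚ + dimAux k (sphere G v)) * (ℤ.+ 1 / suc m)
dimAux-suc k G@(graph (suc m) _ _ _) refl =
  cong (_* (ℤ.+ 1 / suc m)) (sumℚ-allFin (suc m) (λ v → 1ℚ + dimAux k (sphere G v)))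

dimAux-fuel : ∀ k k' G → ∣ G ∣ ≤ k → ∣ G ∣ ≤ k' → dimAux k G ≡ dimAux k' G
dimAux-fuel zero    zero     _                  _ _ = refl
dimAux-fuel zero    (suc _)  (graph zero _ _ _) _ _ = refl
dimAux-fuel (suc _) zero     (graph zero _ _ _) _ _ = refl
dimAux-fuel (suc _) (suc _)  (graph zero _ _ _) _ _ = refl
dimAux-fuel (suc k) (suc k') G@(graph (suc m) _ _ _) (ℕ.s≤s m≤k) (ℕ.s≤s m≤k') = begin
  dimAux (suc k) G                                        ≡⟨ dimAux-suc k G refl ⟩
  sum (λ v → 1ℚ + dimAux k (sphere G v)) * (ℤ.+ 1 / suc m)
    ≡⟨ cong (_* (ℤ.+ 1 / suc m)) (sum-cong-≗ λ v → cong (1ℚ +_)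
         (dimAux-fuel k k' (sphere G v) (bound v m≤k) (bound v m≤k'))) ⟩
  sum (λ v → 1ℚ + dimAux k' (sphere G v)) * (ℤ.+ 1 / suc m) ≡⟨ dimAux-suc k' G refl ⟨
  dimAux (suc k') G                                       ∎
  where
  bound : ∀ v {j} → m ≤ j → ∣ sphere G v ∣ ≤ j
  bound v = ℕ.≤-trans (ℕ.≤-pred (sphere-smaller G v))

dimAux≡dim : ∀ k G → ∣ G ∣ ≤ k → dimAux k G ≡ dim G
dimAux≡dim k G ∣G∣≤k = dimAux-fuel k ∣ G ∣ G ∣G∣≤k ℕ.≤-refl

dim-unfold : ∀ {m} G → ∣ G ∣ ≡ suc m → dim G ≡ sum (dimAt G) * (ℤ.+ 1 / suc m)
dim-unfold G@(graph (suc m) _ _ _) refl = trans (dimAux-suc m G refl)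
  (cong (_* (ℤ.+ 1 / suc m)) (sum-cong-≗ λ v → cong (1ℚ +_)
    (dimAux≡dim m (sphere G v) (ℕ.≤-pred (sphere-smaller G v)))))

sum-dimAt : ∀ G → sum (dimAt G) ≡ ∣ G ∣ × dim G
sum-dimAt (graph zero _ _ _)      = refl
sum-dimAt G@(graph (suc m) _ _ _) =
  ≡.sym (trans (cong (suc m ×_) (dim-unfold G refl)) (n×[x/n]≡x m (sum (dimAt G))))

sum-dimAt⇒dim : ∀ G {c} → 0 < ∣ G ∣ → sum (dimAt G) ≡ ∣ G ∣ × c → dim G ≡ c
sum-dimAt⇒dim G@(graph (suc m) _ _ _) {c} _ sum≡ =
  trans (dim-unfold G refl) (trans (cong (_* (ℤ.+ 1 / suc m)) sum≡) ([n×x]/n≡x m c))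

sum-dimAt-+ : ∀ G c → sum (λ v → dimAt G v + c) ≡ ∣ G ∣ × (dim G + c)
sum-dimAt-+ G c = begin
  sum (λ v → dimAt G v + c)             ≡⟨ ∑-distrib-+ {∣ G ∣} (dimAt G) (λ _ → c) ⟩
  sum (dimAt G) + sum {∣ G ∣} (λ _ → c) ≡⟨ cong₂ _+_ (sum-dimAt G) (sum-replicate ∣ G ∣ {c}) ⟩
  ∣ G ∣ × dim G + ∣ G ∣ × c             ≡⟨ ×-distrib-+ (dim G) c ∣ G ∣ ⟨
  ∣ G ∣ × (dim G + c)                   ∎

index-∈-lookup : ∀ {A : Set} (xs : List A) i → index (∈-lookup {xs = xs} i) ≡ i
index-∈-lookup (x ∷ xs) zero    = refl
index-∈-lookup (x ∷ xs) (suc i) = cong suc (index-∈-lookup xs i)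

index-subst : ∀ {A : Set} {xs : List A} {x y : A} (x≡y : x ≡ y) (x∈xs : x ∈ xs) →
              index (subst (_∈ xs) x≡y x∈xs) ≡ index x∈xs
index-subst refl _ = refl

lookup-injective : ∀ {A : Set} {xs : List A} → Unique xs → ∀ {i j} → lookup xs i ≡ lookup xs j → i ≡ j
lookup-injective {xs = xs} xs! {i} {j} eq = begin
  i                                      ≡⟨ index-∈-lookup xs i ⟨
  index (∈-lookup i)                     ≡⟨ index-subst eq (∈-lookup i) ⟨
  index (subst (_∈ xs) eq (∈-lookup i))  ≡⟨ cong index (unique⇒irrelevant xs! _ (∈-lookup j)) ⟩
  index (∈-lookup j)                     ≡⟨ index-∈-lookup xs j ⟩
  j                                      ∎

neighbours-unique : ∀ G v → Unique (neighbours G v)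
neighbours-unique G v = filter⁺ (T? ∘ adj G v) (allFin⁺ ∣ G ∣)

adj-lookup-neighbours : ∀ G v i → adj G v (lookup (neighbours G v) i) ≡ true
adj-lookup-neighbours G v i =
  Equivalence.to T-≡ (proj₂ (∈-filter⁻ (T? ∘ adj G v) {xs = allFin ∣ G ∣} (∈-lookup i)))

∈-neighbours : ∀ G v {x} → adj G v x ≡ true → x ∈ neighbours G v
∈-neighbours G v {x} vx = ∈-filter⁺ (T? ∘ adj G v) (∈-allFin x) (Equivalence.from T-≡ vx)

-- Graph isomorphisms

record _≅_ (G H : Graph) : Set where
  field
    to      : Fin ∣ G ∣ → Fin ∣ H ∣
    from    : Fin ∣ H ∣ → Fin ∣ G ∣
    from∘to : ∀ i → from (to i) ≡ i
    to∘from : ∀ j → to (from j) ≡ j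
    adj-to  : ∀ i j → adj H (to i) (to j) ≡ adj G i j

record InducedBy {X : Set} (R : X → X → Bool) (p : X → Bool) (G : Graph) : Set where
  field
    vertex           : Fin ∣ G ∣ → X
    vertex-injective : ∀ {i j} → vertex i ≡ vertex j → i ≡ j
    adj-vertex       : ∀ i j → adj G i j ≡ R (vertex i) (vertex j)
    p-vertex         : ∀ i → p (vertex i) ≡ true
    vertex-onto      : ∀ x → p x ≡ true → Σ (Fin ∣ G ∣) λ i → vertex i ≡ x

≅-induced : ∀ {X : Set} {R : X → X → Bool} {p G H} → InducedBy R p G → InducedBy R p H → G ≅ H
≅-induced {R = R} {G = G} {H} G↪ H↪ = record
  { to      = to
  ; from    = from
  ; from∘to = λ i → G↪.vertex-injective (trans (from-vertex (to i)) (to-vertex i))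
  ; to∘from = λ j → H↪.vertex-injective (trans (to-vertex (from j)) (from-vertex j))
  ; adj-to  = λ i j → trans (H↪.adj-vertex (to i) (to j))
                       (trans (cong₂ R (to-vertex i) (to-vertex j)) (≡.sym (G↪.adj-vertex i j)))
  }
  where
  module G↪ = InducedBy G↪
  module H↪ = InducedBy H↪
  to : Fin ∣ G ∣ → Fin ∣ H ∣
  to i = proj₁ (H↪.vertex-onto (G↪.vertex i) (G↪.p-vertex i))
  to-vertex : ∀ i → H↪.vertex (to i) ≡ G↪.vertex i
  to-vertex i = proj₂ (H↪.vertex-onto (G↪.vertex i) (G↪.p-vertex i))
  from : Fin ∣ H ∣ → Fin ∣ G ∣
  from j = proj₁ (G↪.vertex-onto (H↪.vertex j) (H↪.p-vertex j))
  from-vertex : ∀ j → G↪.vertex (from j) ≡ H↪.vertex j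
  from-vertex j = proj₂ (G↪.vertex-onto (H↪.vertex j) (H↪.p-vertex j))

≅-refl : ∀ {G} → G ≅ G
≅-refl = record
  { to = id ; from = id ; from∘to = λ _ → refl ; to∘from = λ _ → refl ; adj-to = λ _ _ → refl }

≅⇒induced : ∀ {G H} (G≅H : G ≅ H) → InducedBy (adj H) (λ _ → true) G
≅⇒induced {G} {H} G≅H = record
  { vertex           = to
  ; vertex-injective = λ {i} {j} eq → trans (≡.sym (from∘to i)) (trans (cong from eq) (from∘to j))
  ; adj-vertex       = λ i j → ≡.sym (adj-to i j)
  ; p-vertex         = λ _ → refl
  ; vertex-onto      = λ x _ → from x , to∘from x
  }
  where open _≅_ G≅H

sphere-induced : ∀ {X : Set} {R : X → X → Bool} {G} (G↪ : InducedBy R (λ _ → true) G) v →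
                 InducedBy R (R (InducedBy.vertex G↪ v)) (sphere G v)
sphere-induced {R = R} {G} G↪ v = record
  { vertex           = vertex ∘ lookup (neighbours G v)
  ; vertex-injective = lookup-injective (neighbours-unique G v) ∘ vertex-injective
  ; adj-vertex       = λ i j → adj-vertex _ _
  ; p-vertex         = λ i → trans (≡.sym (adj-vertex v _)) (adj-lookup-neighbours G v i)
  ; vertex-onto      = onto
  }
  where
  open InducedBy G↪
  onto : ∀ x → R (vertex v) x ≡ true →
         Σ (Fin ∣ sphere G v ∣) λ i → vertex (lookup (neighbours G v) i) ≡ x
  onto x vx with y , y↦x ← vertex-onto x refl =
    index y∈ , trans (cong vertex (≡.sym (lookup-index y∈))) y↦x
    where
    y∈ : y ∈ neighbours G v
    y∈ = ∈-neighbours G v (trans (adj-vertex v y) (trans (cong (R (vertex v)) y↦x) vx))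

sphere-≅ : ∀ {G H} (G≅H : G ≅ H) v → sphere G v ≅ sphere H (_≅_.to G≅H v)
sphere-≅ {H = H} G≅H v =
  ≅-induced (sphere-induced (≅⇒induced G≅H) v) (sphere-induced (≅⇒induced (≅-refl {H})) (_≅_.to G≅H v))

≅⇒Permutation : ∀ {G H} → G ≅ H → Permutation ∣ G ∣ ∣ H ∣
≅⇒Permutation G≅H = permutation to from to∘from from∘to
  where open _≅_ G≅H

≅⇒∣∣≡ : ∀ {G H} → G ≅ H → ∣ G ∣ ≡ ∣ H ∣
≅⇒∣∣≡ = ↔⇒≡ ∘ ≅⇒Permutation

dimAux-≅ : ∀ k {G H} → G ≅ H → dimAux k G ≡ dimAux k H
dimAux-≅ zero    _ = refl
dimAux-≅ (suc k) {graph zero _ _ _} {graph zero _ _ _} _ = refl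
dimAux-≅ (suc k) {graph zero _ _ _} {graph (suc _) _ _ _} G≅H with () ← ≅⇒∣∣≡ G≅H
dimAux-≅ (suc k) {graph (suc _) _ _ _} {graph zero _ _ _} G≅H with () ← ≅⇒∣∣≡ G≅H
dimAux-≅ (suc k) {G@(graph (suc m) _ _ _)} {H@(graph (suc _) _ _ _)} G≅H
  with refl ← ≅⇒∣∣≡ G≅H = begin
  dimAux (suc k) G                                       ≡⟨ dimAux-suc k G refl ⟩
  sum (λ v → 1ℚ + dimAux k (sphere G v)) * (ℤ.+ 1 / suc m)
    ≡⟨ cong (_* (ℤ.+ 1 / suc m)) (sum-cong-≗ λ v → cong (1ℚ +_) (dimAux-≅ k (sphere-≅ G≅H v))) ⟩
  sum (λ v → 1ℚ + dimAux k (sphere H (to v))) * (ℤ.+ 1 / suc m)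
    ≡⟨ cong (_* (ℤ.+ 1 / suc m)) (sum-permute (λ w → 1ℚ + dimAux k (sphere H w)) (≅⇒Permutation G≅H)) ⟨
  sum (λ w → 1ℚ + dimAux k (sphere H w)) * (ℤ.+ 1 / suc m) ≡⟨ dimAux-suc k H refl ⟨
  dimAux (suc k) H                                       ∎
  where open _≅_ G≅H

dim-≅ : ∀ {G H} → G ≅ H → dim G ≡ dim H
dim-≅ {G} {H} G≅H =
  trans (dimAux-≅ ∣ G ∣ G≅H) (dimAux≡dim ∣ G ∣ H (ℕ.≤-reflexive (≡.sym (≅⇒∣∣≡ G≅H))))

-- Unit spheres of a join

splitAt-injective : ∀ m {n} {i j : Fin (m ℕ.+ n)} → splitAt m i ≡ splitAt m j → i ≡ j
splitAt-injective m {n} {i} {j} eq =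
  trans (≡.sym (join-splitAt m n i)) (trans (cong (Fin.join m n) eq) (join-splitAt m n j))

swap-injective : ∀ {A B : Set} {s t : A ⊎ B} → swap s ≡ swap t → s ≡ t
swap-injective {s = s} {t} eq = trans (≡.sym (swap-involutive s)) (trans (cong swap eq) (swap-involutive t))

joinAdj-swap : ∀ G₁ G₂ s t → joinAdj G₂ G₁ s t ≡ joinAdj G₁ G₂ (swap s) (swap t)
joinAdj-swap G₁ G₂ (inj₁ _) (inj₁ _) = refl
joinAdj-swap G₁ G₂ (inj₁ _) (inj₂ _) = refl
joinAdj-swap G₁ G₂ (inj₂ _) (inj₁ _) = refl
joinAdj-swap G₁ G₂ (inj₂ _) (inj₂ _) = refl

join-induced : ∀ G₁ G₂ → InducedBy (joinAdj G₁ G₂) (λ _ → true) (join G₁ G₂)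
join-induced G₁ G₂ = record
  { vertex           = splitAt n₁
  ; vertex-injective = splitAt-injective n₁
  ; adj-vertex       = λ _ _ → refl
  ; p-vertex         = λ _ → refl
  ; vertex-onto      = λ s _ → Fin.join n₁ n₂ s , splitAt-join n₁ n₂ s
  }
  where n₁ = ∣ G₁ ∣; n₂ = ∣ G₂ ∣

join-swap-induced : ∀ G₁ G₂ → InducedBy (joinAdj G₁ G₂) (λ _ → true) (join G₂ G₁)
join-swap-induced G₁ G₂ = record
  { vertex           = swap ∘ splitAt n₂
  ; vertex-injective = splitAt-injective n₂ ∘ swap-injective
  ; adj-vertex       = λ i j → joinAdj-swap G₁ G₂ (splitAt n₂ i) (splitAt n₂ j)
  ; p-vertex         = λ _ → refl
  ; vertex-onto      = λ s _ → Fin.join n₂ n₁ (swap s) ,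
                               trans (cong swap (splitAt-join n₂ n₁ (swap s))) (swap-involutive s)
  }
  where n₁ = ∣ G₁ ∣; n₂ = ∣ G₂ ∣

join-comm-≅ : ∀ G₁ G₂ → join G₁ G₂ ≅ join G₂ G₁
join-comm-≅ G₁ G₂ = ≅-induced (join-induced G₁ G₂) (join-swap-induced G₁ G₂)

join-sphere-induced : ∀ G₁ G₂ a →
                      InducedBy (joinAdj G₁ G₂) (joinAdj G₁ G₂ (inj₁ a)) (join (sphere G₁ a) G₂)
join-sphere-induced G₁ G₂ a = record
  { vertex           = lift ∘ splitAt ∣ S ∣
  ; vertex-injective = splitAt-injective ∣ S ∣ ∘ lift-injective
  ; adj-vertex       = λ i j → joinAdj-lift (splitAt ∣ S ∣ i) (splitAt ∣ S ∣ j)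
  ; p-vertex         = λ i → adjacent-lift (splitAt ∣ S ∣ i)
  ; vertex-onto      = λ s as → let t , t↦s = lift-onto s as in
      Fin.join (∣ S ∣) (∣ G₂ ∣) t , trans (cong lift (splitAt-join (∣ S ∣) (∣ G₂ ∣) t)) t↦s
  }
  where
  S = sphere G₁ a
  lift : Fin ∣ S ∣ ⊎ Fin ∣ G₂ ∣ → Fin ∣ G₁ ∣ ⊎ Fin ∣ G₂ ∣
  lift = Sum.map (lookup (neighbours G₁ a)) id
  lift-injective : ∀ {s t} → lift s ≡ lift t → s ≡ t
  lift-injective {inj₁ _} {inj₁ _} eq =
    cong inj₁ (lookup-injective (neighbours-unique G₁ a) (inj₁-injective eq))
  lift-injective {inj₂ _} {inj₂ _} eq = cong inj₂ (inj₂-injective eq)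
  joinAdj-lift : ∀ s t → joinAdj S G₂ s t ≡ joinAdj G₁ G₂ (lift s) (lift t)
  joinAdj-lift (inj₁ _) (inj₁ _) = refl
  joinAdj-lift (inj₁ _) (inj₂ _) = refl
  joinAdj-lift (inj₂ _) (inj₁ _) = refl
  joinAdj-lift (inj₂ _) (inj₂ _) = refl
  adjacent-lift : ∀ s → joinAdj G₁ G₂ (inj₁ a) (lift s) ≡ true
  adjacent-lift (inj₁ i) = adj-lookup-neighbours G₁ a i
  adjacent-lift (inj₂ _) = refl
  lift-onto : ∀ s → joinAdj G₁ G₂ (inj₁ a) s ≡ true → Σ (Fin ∣ S ∣ ⊎ Fin ∣ G₂ ∣) λ t → lift t ≡ s
  lift-onto (inj₁ b) ab = inj₁ (index b∈) , cong inj₁ (≡.sym (lookup-index b∈))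
    where b∈ = ∈-neighbours G₁ a ab
  lift-onto (inj₂ c) _  = inj₂ c , refl

sphere-join-↑ˡ-≅ : ∀ G₁ G₂ a → sphere (join G₁ G₂) (a ↑ˡ ∣ G₂ ∣) ≅ join (sphere G₁ a) G₂
sphere-join-↑ˡ-≅ G₁ G₂ a = ≅-induced sphere-in-join (join-sphere-induced G₁ G₂ a)
  where
  S = sphere (join G₁ G₂) (a ↑ˡ ∣ G₂ ∣)
  sphere-in-join : InducedBy (joinAdj G₁ G₂) (joinAdj G₁ G₂ (inj₁ a)) S
  sphere-in-join = subst (λ s → InducedBy (joinAdj G₁ G₂) (joinAdj G₁ G₂ s) S) (splitAt-↑ˡ (∣ G₁ ∣) a (∣ G₂ ∣))
                         (sphere-induced (join-induced G₁ G₂) (a ↑ˡ ∣ G₂ ∣))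

dim-sphere-join-↑ʳ : ∀ G₁ G₂ c → dim (sphere (join G₁ G₂) (∣ G₁ ∣ ↑ʳ c)) ≡ dim (join (sphere G₂ c) G₁)
dim-sphere-join-↑ʳ G₁ G₂ c = begin
  dim (sphere (join G₁ G₂) (n₁ ↑ʳ c))
    ≡⟨ dim-≅ (sphere-≅ (join-comm-≅ G₁ G₂) (n₁ ↑ʳ c)) ⟩
  dim (sphere (join G₂ G₁) (Fin.join n₂ n₁ (swap (splitAt n₁ (n₁ ↑ʳ c)))))
    ≡⟨ cong (λ s → dim (sphere (join G₂ G₁) (Fin.join n₂ n₁ (swap s)))) (splitAt-↑ʳ n₁ n₂ c) ⟩
  dim (sphere (join G₂ G₁) (c ↑ˡ n₁))    ≡⟨ dim-≅ (sphere-join-↑ˡ-≅ G₂ G₁ c) ⟩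
  dim (join (sphere G₂ c) G₁)            ∎
  where n₁ = ∣ G₁ ∣; n₂ = ∣ G₂ ∣

DimJoinFormula : Graph → Graph → Set
DimJoinFormula G₁ G₂ = dim (join G₁ G₂) ≡ 1ℚ + dim G₁ + dim G₂

dim-join-empty : ∀ G₁ G₂ → ∣ G₁ ∣ ℕ.+ ∣ G₂ ∣ ≡ 0 → DimJoinFormula G₁ G₂
dim-join-empty (graph zero _ _ _)    (graph zero _ _ _)    _  = refl
dim-join-empty (graph zero _ _ _)    (graph (suc _) _ _ _) ()
dim-join-empty (graph (suc _) _ _ _) _                     ()

dim-join-step : ∀ G₁ G₂ → 0 < ∣ G₁ ∣ ℕ.+ ∣ G₂ ∣ →
                (∀ H₁ H₂ → ∣ H₁ ∣ ℕ.+ ∣ H₂ ∣ < ∣ G₁ ∣ ℕ.+ ∣ G₂ ∣ → DimJoinFormula H₁ H₂) →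
                DimJoinFormula G₁ G₂
dim-join-step G₁ G₂ 0<∣J∣ smaller = sum-dimAt⇒dim J 0<∣J∣ (begin
  sum (dimAt J)                               ≡⟨ sum-↑ˡ-↑ʳ n₁ n₂ (dimAt J) ⟩
  sum (dimAt J ∘ (_↑ˡ n₂)) + sum (dimAt J ∘ (n₁ ↑ʳ_))
    ≡⟨ cong₂ _+_ (sum-cong-≗ dimAt-↑ˡ) (sum-cong-≗ dimAt-↑ʳ) ⟩
  sum (λ a → dimAt G₁ a + (1ℚ + d₂)) + sum (λ c → dimAt G₂ c + (1ℚ + d₁))
    ≡⟨ cong₂ _+_ (sum-dimAt-+ G₁ (1ℚ + d₂)) (sum-dimAt-+ G₂ (1ℚ + d₁)) ⟩
  n₁ × (d₁ + (1ℚ + d₂)) + n₂ × (d₂ + (1ℚ + d₁))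
    ≡⟨ cong₂ (λ x y → n₁ × x + n₂ × y) (shuffle₁ d₁ d₂) (shuffle₂ d₂ d₁) ⟩
  n₁ × (1ℚ + d₁ + d₂) + n₂ × (1ℚ + d₁ + d₂)   ≡⟨ ×-homo-+ (1ℚ + d₁ + d₂) n₁ n₂ ⟨
  (n₁ ℕ.+ n₂) × (1ℚ + d₁ + d₂)                ∎)
  where
  open +-*-Solver
  J = join G₁ G₂
  n₁ = ∣ G₁ ∣
  n₂ = ∣ G₂ ∣
  d₁ = dim G₁
  d₂ = dim G₂
  shuffle₀ : ∀ x d → 1ℚ + (1ℚ + x + d) ≡ (1ℚ + x) + (1ℚ + d)
  shuffle₀ = solve 2 (λ x d → con 1ℚ :+ (con 1ℚ :+ x :+ d) := (con 1ℚ :+ x) :+ (con 1ℚ :+ d)) refl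
  shuffle₁ : ∀ x d → x + (1ℚ + d) ≡ 1ℚ + x + d
  shuffle₁ = solve 2 (λ x d → x :+ (con 1ℚ :+ d) := con 1ℚ :+ x :+ d) refl
  shuffle₂ : ∀ x d → x + (1ℚ + d) ≡ 1ℚ + d + x
  shuffle₂ = solve 2 (λ x d → x :+ (con 1ℚ :+ d) := con 1ℚ :+ d :+ x) refl
  dimAt-↑ˡ : ∀ a → dimAt J (a ↑ˡ n₂) ≡ dimAt G₁ a + (1ℚ + d₂)
  dimAt-↑ˡ a = trans (cong (1ℚ +_) (trans (dim-≅ (sphere-join-↑ˡ-≅ G₁ G₂ a))
                                          (smaller (sphere G₁ a) G₂ size)))
                     (shuffle₀ (dim (sphere G₁ a)) d₂)
    where
    size : ∣ sphere G₁ a ∣ ℕ.+ n₂ < n₁ ℕ.+ n₂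
    size = ℕ.+-monoˡ-< n₂ (sphere-smaller G₁ a)
  dimAt-↑ʳ : ∀ c → dimAt J (n₁ ↑ʳ c) ≡ dimAt G₂ c + (1ℚ + d₁)
  dimAt-↑ʳ c = trans (cong (1ℚ +_) (trans (dim-sphere-join-↑ʳ G₁ G₂ c)
                                          (smaller (sphere G₂ c) G₁ size)))
                     (shuffle₀ (dim (sphere G₂ c)) d₁)
    where
    size : ∣ sphere G₂ c ∣ ℕ.+ n₁ < n₁ ℕ.+ n₂
    size = subst (∣ sphere G₂ c ∣ ℕ.+ n₁ <_) (ℕ.+-comm n₂ n₁) (ℕ.+-monoˡ-< n₁ (sphere-smaller G₂ c))

lemma2 : (G₁ G₂ : Graph) → dim (join G₁ G₂) ≡ 1ℚ + dim G₁ + dim G₂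
lemma2 G₁ G₂ = <-rec P step (∣ G₁ ∣ ℕ.+ ∣ G₂ ∣) G₁ G₂ refl
  where
  P : ℕ → Set
  P k = ∀ G₁ G₂ → ∣ G₁ ∣ ℕ.+ ∣ G₂ ∣ ≡ k → DimJoinFormula G₁ G₂
  step : ∀ k → (∀ {j} → j < k → P j) → P k
  step zero    _  G₁ G₂ ∣J∣≡0 = dim-join-empty G₁ G₂ ∣J∣≡0
  step (suc k) ih G₁ G₂ ∣J∣≡1+k =
    dim-join-step G₁ G₂ (subst (0 <_) (≡.sym ∣J∣≡1+k) z<s)
      (λ H₁ H₂ lt → ih (subst (∣ H₁ ∣ ℕ.+ ∣ H₂ ∣ <_) ∣J∣≡1+k lt) H₁ H₂ refl)
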